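{- Let $P_1$ and $P_2$ be two logic programs. Then $P_1$ and $P_2$ are strongly equivalent with respect to the min-answer set semantics (i.e. for every logic program $P$, the programs $P_1\cup P$ and $P_2\cup P$ have exactly the same min-answer sets) if and only if $P_1$ and $P_2$ are equivalent in Gödel's three-valued logic $G_3$.
   Context: Formulas are propositional over atoms with $\land,\lor,\leftarrow$ (implication, $H\leftarrow B$ meaning "$B$ implies $H$") and $\bot$; $\neg F$ abbreviates $\bot\leftarrow F$, $\top$ abbreviates $\bot\leftarrow\bot$. A logic program is a finite set of formulas; $\sigma_P$ is the set of atoms occurring in $P$. Answer sets of a logic program $P$: a set of atoms $M$ is an answer set of $P$ if $P\cup\{\neg a:a\in\sigma_P\setminus M\}\cup\{\neg\neg a:a\in M\}$ is consistent in intuitionistic logic and intuitionistically proves every atom of $M$ (for augmented programs, i.e. sets of clauses $H\leftarrow B$ with $H,B$ built from atoms, $\bot,\top$ by $\land,\lor,\neg$, this coincides with the usual reduct-based definition of answer sets for programs with nested expressions). A set of atoms $M$ is a model of $P$ if the classical interpretation making exactly the atoms of $M$ true satisfies all formulas of $P$; a minimal model if no proper subset is a model. A min-answer set is a set that is both an answer set and a minimal model. Gödel's logic $G_3$: interpretations assign to atoms values in $\{0,1,2\}$, extended by $I(A\land B)=\min(I(A),I(B))$, $I(A\lor B)=\max(I(A),I(B))$, $I(\bot)=0$, $I(B\leftarrow A)=2$ if $I(A)\le I(B)$ and $I(B)$ otherwise. $I$ models a program if every formula gets value 2. $T\vdash_{G_3}F$ means $(F_1\land\dots\land F_n)\to F$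 gets value 2 under every interpretation for some $F_i\in T$; $P_1$ and $P_2$ are equivalent in $G_3$ if $P_1\vdash_{G_3}F$ for all $F\in P_2$ and $P_2\vdash_{G_3}F$ for all $F\in P_1$. -}

module Defs where

open import Data.Nat using (ℕ; _≤ᵇ_)
open import Data.Bool using (Bool; true; false; _∧_; _∨_; if_then_else_)
open import Data.List using (List; []; _∷_; _++_; map; filter)
open import Data.List.Membership.Propositional using (_∈_; _∉_)
open import Data.List.Membership.DecPropositional (Data.Nat._≟_) using (_∈?_)
open import Data.List.Relation.Binary.Subset.Propositional using (_⊆_)
open import Data.List.Relation.Unary.All using (All)
open import Data.Product using (_×_; Σ; ∃)
open import Relation.Nullary using (¬_; does; ¬?)
open import Relation.Binary.PropositionalEquality using (_≡_)
open import Function.Bundles using (_⇔_)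
import Data.Nat as N

Atom : Set
Atom = ℕ

-- Propositional formulas over ∧, ∨, ← and ⊥.
-- H ⇐ B  is the implication "H ← B" (B implies H).
infixr 6 _∧f_
infixr 5 _∨f_
infixl 4 _⇐_
data Formula : Set where
  atom : Atom → Formula
  ⊥f   : Formula
  _∧f_ : Formula → Formula → Formula
  _∨f_ : Formula → Formula → Formula
  _⇐_  : Formula → Formula → Formula

¬f_ : Formula → Formula
¬f F = ⊥f ⇐ F

⊤f : Formula
⊤f = ⊥f ⇐ ⊥f

Program : Set
Program = List Formula

atomsF : Formula → List Atom
atomsF (atom a) = a ∷ []
atomsF ⊥f = []
atomsF (F ∧f G) = atomsF F ++ atomsF G
atomsF (F ∨f G) = atomsF F ++ atomsF G
atomsF (H ⇐ B) = atomsF H ++ atomsF B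

σ : Program → List Atom
σ [] = []
σ (F ∷ P) = atomsF F ++ σ P

infix 2 _⊢_
data _⊢_ (Γ : List Formula) : Formula → Set where
  hyp  : ∀ {F} → F ∈ Γ → Γ ⊢ F
  ∧I   : ∀ {F G} → Γ ⊢ F → Γ ⊢ G → Γ ⊢ F ∧f G
  ∧E₁  : ∀ {F G} → Γ ⊢ F ∧f G → Γ ⊢ F
  ∧E₂  : ∀ {F G} → Γ ⊢ F ∧f G → Γ ⊢ G
  ∨I₁  : ∀ {F G} → Γ ⊢ F → Γ ⊢ F ∨f G
  ∨I₂  : ∀ {F G} → Γ ⊢ G → Γ ⊢ F ∨f G
  ∨E   : ∀ {F G H} → Γ ⊢ F ∨f G → (F ∷ Γ) ⊢ H → (G ∷ Γ) ⊢ H → Γ ⊢ H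
  ⇐I   : ∀ {H B} → (B ∷ Γ) ⊢ H → Γ ⊢ H ⇐ B
  ⇐E   : ∀ {H B} → Γ ⊢ H ⇐ B → Γ ⊢ B → Γ ⊢ H
  ⊥E   : ∀ {F} → Γ ⊢ ⊥f → Γ ⊢ F

-- Answer sets (intuitionistic characterisation)

completion : Program → List Atom → List Formula
completion P M =
  P ++ map (λ a → ¬f atom a) (filter (λ a → ¬? (a ∈? M)) (σ P))
    ++ map (λ a → ¬f (¬f atom a)) M

IsAnswerSet : Program → List Atom → Set
IsAnswerSet P M =
  (¬ (completion P M ⊢ ⊥f)) × (∀ a → a ∈ M → completion P M ⊢ atom a)

evalC : List Atom → Formula → Bool
evalC M (atom a) = does (a ∈? M)
evalC M ⊥f = false
evalC M (F ∧f G) = evalC M F ∧ evalC M G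
evalC M (F ∨f G) = evalC M F ∨ evalC M G
evalC M (H ⇐ B) = if evalC M B then evalC M H else true

IsModel : Program → List Atom → Set
IsModel P M = All (λ F → evalC M F ≡ true) P

IsMinimalModel : Program → List Atom → Set
IsMinimalModel P M =
  IsModel P M × (∀ M′ → M′ ⊆ M → ¬ (M ⊆ M′) → ¬ IsModel P M′)

IsMinAnswerSet : Program → List Atom → Set
IsMinAnswerSet P M = IsAnswerSet P M × IsMinimalModel P M

StronglyEquivalentMin : Program → Program → Set
StronglyEquivalentMin P₁ P₂ =
  ∀ (P : Program) (M : List Atom) →
    IsMinAnswerSet (P₁ ++ P) M ⇔ IsMinAnswerSet (P₂ ++ P) M

Interp : Set
Interp = Atom → ℕ

ValidInterp : Interp → Set
ValidInterp I = ∀ a → I a N.≤ 2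

evalG : Interp → Formula → ℕ
evalG I (atom a) = I a
evalG I ⊥f = 0
evalG I (F ∧f G) = evalG I F N.⊓ evalG I G
evalG I (F ∨f G) = evalG I F N.⊔ evalG I G
evalG I (H ⇐ B) = if evalG I B ≤ᵇ evalG I H then 2 else evalG I H

conj : List Formula → Formula
conj [] = ⊤f
conj (F ∷ []) = F
conj (F ∷ Fs@(_ ∷ _)) = F ∧f conj Fs

G3Valid : Formula → Set
G3Valid F = ∀ (I : Interp) → ValidInterp I → evalG I F ≡ 2

_⊢G3_ : Program → Formula → Set
T ⊢G3 F = Σ (List Formula) λ Fs → All (_∈ T) Fs × G3Valid (F ⇐ conj Fs)

G3Equivalent : Program → Program → Set
G3Equivalent P₁ P₂ = All (P₁ ⊢G3_) P₂ × All (P₂ ⊢G3_) P₁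

-- A G₃-interpretation is a here-and-there model: its non-zero atoms are true "there", its
-- atoms valued 2 true "here".  Soundness of intuitionistic logic for G₃, and a converse
-- relative to G = ⋀ M, show that a classical model M of Q is an answer set exactly when it
-- is an equilibrium model: no G₃-model of Q that is non-zero exactly on M takes the value 1.
-- So min-answer sets depend only on G₃-models, and G₃-equivalent programs are strongly
-- equivalent.  Conversely let P₁, P₂ be strongly equivalent and J a G₃-model of P₁, non-zero
-- exactly on T, that is not a model of P₂.  Adding the atoms of a classical model as facts
-- shows that P₁ and P₂ have the same classical models, so T is a model of P₂.  Adding instead
-- the facts valued 2 by J, ¬¬a for a ∈ T and a ← b for all a, b valued 1 makes T a
-- min-answer set of P₂ ∪ P, since J is the only possible witness against equilibrium.  Then
-- T is one of P₁ ∪ P as well, whose equilibrium forces J to be two-valued, hence a model of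
-- P₂ after all.
module Submission where

open import Defs
open import Function.Base using (id; _∘_; _∘′_; _on_)
open import Function.Bundles using (_⇔_; mk⇔; Equivalence)
open import Function.Properties.Equivalence using () renaming (sym to ⇔-sym)
open import Data.Bool using (Bool; true; false; T; _∧_; _∨_; if_then_else_)
open import Data.Nat using (ℕ; _≤_; _<_; _⊓_; _⊔_; _≤ᵇ_; z≤n; s≤s; _≟_)
open import Data.Nat.Properties
  using ( ≤-refl; ≤-reflexive; ≤-trans; ≤-total; ≤ᵇ⇒≤; ≤⇒≤ᵇ; ⊓-glb; m⊓n≤m; m⊓n≤n
        ; m≤n⇒m⊓n≡m; m≥n⇒m⊓n≡n; ⊔-sel; m≤n⇒m≤n⊔o; m≤n⇒m≤o⊔n )
open import Data.Nat.Induction using (<-wellFounded)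
open import Induction.WellFounded using (Acc; acc)
import Relation.Binary.Construct.On as On
open import Data.Product using (_×_; _,_; proj₁; proj₂)
open import Data.Sum using (inj₁; inj₂)
open import Data.List using (List; []; _∷_; _++_; map; filter; length; cartesianProductWith)
open import Data.List.Properties using (filter-notAll)
open import Data.List.Membership.Propositional using (_∈_; _∉_; find)
open import Data.List.Membership.Propositional.Properties
  using ( ∈-++⁺ˡ; ∈-++⁺ʳ; ∈-map⁺; ∈-filter⁺; ∈-filter⁻
        ; ∈-cartesianProductWith⁺; ∈-cartesianProductWith⁻ )
open import Data.List.Membership.DecPropositional _≟_ using (_∈?_)
open import Data.List.Relation.Binary.Subset.Propositional using (_⊆_)
open import Data.List.Relation.Binary.Subset.Propositional.Properties using (∷⁺ʳ)
open import Data.List.Relation.Unary.Any using (here; there)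
import Data.List.Relation.Unary.Any as Any
open import Data.List.Relation.Unary.All using (All; []; _∷_)
import Data.List.Relation.Unary.All as All
import Data.List.Relation.Unary.All.Properties as AllP
open import Data.List.Relation.Unary.All.Properties using (¬All⇒Any¬)
open import Relation.Nullary using (¬_; ¬?; Dec; yes; no; does; contradiction)
open import Relation.Nullary.Decidable using (T?; dec-true; dec-false; decidable-stable)
open import Relation.Binary.Definitions using (DecidableEquality)
open import Relation.Binary.PropositionalEquality
  using (_≡_; _≢_; _≗_; refl; sym; trans; cong; cong₂; subst; module ≡-Reasoning)
open ≡-Reasoning

private
  variable
    Γ Δ : List Formula
    φ ψ χ : Formula

data V : Set where
  v0 v1 v2 : V

_≟ᵥ_ : DecidableEquality V
v0 ≟ᵥ v0 = yes refl
v0 ≟ᵥ v1 = no λ ()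
v0 ≟ᵥ v2 = no λ ()
v1 ≟ᵥ v0 = no λ ()
v1 ≟ᵥ v1 = yes refl
v1 ≟ᵥ v2 = no λ ()
v2 ≟ᵥ v0 = no λ ()
v2 ≟ᵥ v1 = no λ ()
v2 ≟ᵥ v2 = yes refl

infixr 7 _⊓ᵥ_
infixr 6 _⊔ᵥ_
infixl 5 _⇐ᵥ_

_⊓ᵥ_ : V → V → V
v0 ⊓ᵥ _  = v0
v1 ⊓ᵥ v0 = v0
v1 ⊓ᵥ _  = v1
v2 ⊓ᵥ y  = y

_⊔ᵥ_ : V → V → V
v0 ⊔ᵥ y  = y
v1 ⊔ᵥ v2 = v2
v1 ⊔ᵥ _  = v1
v2 ⊔ᵥ _  = v2

_⇐ᵥ_ : V → V → V
_  ⇐ᵥ v0 = v2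
v0 ⇐ᵥ _  = v0
v1 ⇐ᵥ v1 = v2
v1 ⇐ᵥ v2 = v1
v2 ⇐ᵥ _  = v2

evalV : (Atom → V) → Formula → V
evalV J (atom a) = J a
evalV J ⊥f       = v0
evalV J (F ∧f G) = evalV J F ⊓ᵥ evalV J G
evalV J (F ∨f G) = evalV J F ⊔ᵥ evalV J G
evalV J (H ⇐ B)  = evalV J H ⇐ᵥ evalV J B

toℕ : V → ℕ
toℕ v0 = 0
toℕ v1 = 1
toℕ v2 = 2

fromℕ : ℕ → V
fromℕ 0 = v0
fromℕ 1 = v1
fromℕ _ = v2

toℕ-fromℕ : ∀ {n} → n ≤ 2 → toℕ (fromℕ n) ≡ n
toℕ-fromℕ z≤n             = refl
toℕ-fromℕ (s≤s z≤n)       = refl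
toℕ-fromℕ (s≤s (s≤s z≤n)) = refl

toℕ-≤2 : ∀ x → toℕ x ≤ 2
toℕ-≤2 v0 = z≤n
toℕ-≤2 v1 = s≤s z≤n
toℕ-≤2 v2 = s≤s (s≤s z≤n)

2≤toℕ⇒v2 : ∀ {x} → 2 ≤ toℕ x → x ≡ v2
2≤toℕ⇒v2 {v2} _ = refl
2≤toℕ⇒v2 {v1} (s≤s ())

toℕ-⊓ : ∀ x y → toℕ (x ⊓ᵥ y) ≡ toℕ x ⊓ toℕ y
toℕ-⊓ v0 _  = refl
toℕ-⊓ v1 v0 = refl
toℕ-⊓ v1 v1 = refl
toℕ-⊓ v1 v2 = refl
toℕ-⊓ v2 v0 = refl
toℕ-⊓ v2 v1 = refl
toℕ-⊓ v2 v2 = refl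

toℕ-⊔ : ∀ x y → toℕ (x ⊔ᵥ y) ≡ toℕ x ⊔ toℕ y
toℕ-⊔ v0 _  = refl
toℕ-⊔ v1 v0 = refl
toℕ-⊔ v1 v1 = refl
toℕ-⊔ v1 v2 = refl
toℕ-⊔ v2 v0 = refl
toℕ-⊔ v2 v1 = refl
toℕ-⊔ v2 v2 = refl

toℕ-⇐ : ∀ h b → toℕ (h ⇐ᵥ b) ≡ (if toℕ b ≤ᵇ toℕ h then 2 else toℕ h)
toℕ-⇐ _  v0 = refl
toℕ-⇐ v0 v1 = refl
toℕ-⇐ v0 v2 = refl
toℕ-⇐ v1 v1 = refl
toℕ-⇐ v1 v2 = refl
toℕ-⇐ v2 v1 = refl
toℕ-⇐ v2 v2 = refl

evalG-toℕ : ∀ {I J} → I ≗ toℕ ∘ J → ∀ φ → evalG I φ ≡ toℕ (evalV J φ)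
evalG-toℕ I≡J (atom a) = I≡J a
evalG-toℕ I≡J ⊥f       = refl
evalG-toℕ {J = J} I≡J (φ ∧f ψ) rewrite evalG-toℕ I≡J φ | evalG-toℕ I≡J ψ =
  sym (toℕ-⊓ (evalV J φ) (evalV J ψ))
evalG-toℕ {J = J} I≡J (φ ∨f ψ) rewrite evalG-toℕ I≡J φ | evalG-toℕ I≡J ψ =
  sym (toℕ-⊔ (evalV J φ) (evalV J ψ))
evalG-toℕ {J = J} I≡J (φ ⇐ ψ)  rewrite evalG-toℕ I≡J φ | evalG-toℕ I≡J ψ =
  sym (toℕ-⇐ (evalV J φ) (evalV J ψ))

evalG-toℕ∘ : ∀ J φ → evalG (toℕ ∘ J) φ ≡ toℕ (evalV J φ)
evalG-toℕ∘ J = evalG-toℕ (λ _ → refl)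

G3Valid⇔ : ∀ F → G3Valid F ⇔ (∀ J → evalV J F ≡ v2)
G3Valid⇔ F = mk⇔
  (λ valid J → 2≤toℕ⇒v2 (≤-reflexive (trans (sym (valid (toℕ ∘ J) (toℕ-≤2 ∘ J))) (evalG-toℕ∘ J F))))
  (λ valid I I≤2 → trans (evalG-toℕ (λ a → sym (toℕ-fromℕ (I≤2 a))) F) (cong toℕ (valid (fromℕ ∘ I))))

-- Soundness of natural deduction for G₃

⇐-intro : ∀ {v b h} → v ≤ 2 → v ⊓ b ≤ h → v ≤ (if b ≤ᵇ h then 2 else h)
⇐-intro {v} {b} {h} v≤2 v⊓b≤h with b ≤ᵇ h in b≤ᵇh
... | true  = v≤2
... | false with ≤-total v b
...   | inj₁ v≤b = subst (_≤ h) (m≤n⇒m⊓n≡m v≤b) v⊓b≤h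
...   | inj₂ b≤v = contradiction (subst (_≤ h) (m≥n⇒m⊓n≡n b≤v) v⊓b≤h) b≰h
  where
  b≰h : ¬ b ≤ h
  b≰h b≤h = subst T b≤ᵇh (≤⇒≤ᵇ b≤h)

⇐-elim : ∀ {v b h} → v ≤ (if b ≤ᵇ h then 2 else h) → v ≤ b → v ≤ h
⇐-elim {b = b} {h} v≤b⇒h v≤b with b ≤ᵇ h in b≤ᵇh
... | true  = ≤-trans v≤b (≤ᵇ⇒≤ b h (subst T (sym b≤ᵇh) _))
... | false = v≤b⇒h

module _ (I : Interp) where

  -- Stated for every threshold v ≤ 2, since ⇐I checks its premise at the lower
  -- threshold v ⊓ evalG I B.
  ⊢-sound : ∀ {v} → v ≤ 2 → All (λ ψ → v ≤ evalG I ψ) Γ → Γ ⊢ φ → v ≤ evalG I φ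
  ⊢-sound v≤2 Γ≥v (hyp p)  = All.lookup Γ≥v p
  ⊢-sound v≤2 Γ≥v (∧I d e) = ⊓-glb (⊢-sound v≤2 Γ≥v d) (⊢-sound v≤2 Γ≥v e)
  ⊢-sound v≤2 Γ≥v (∧E₁ d)  = ≤-trans (⊢-sound v≤2 Γ≥v d) (m⊓n≤m _ _)
  ⊢-sound v≤2 Γ≥v (∧E₂ d)  = ≤-trans (⊢-sound v≤2 Γ≥v d) (m⊓n≤n _ _)
  ⊢-sound v≤2 Γ≥v (∨I₁ {G = G} d) = m≤n⇒m≤n⊔o (evalG I G) (⊢-sound v≤2 Γ≥v d)
  ⊢-sound v≤2 Γ≥v (∨I₂ {F = F} d) = m≤n⇒m≤o⊔n (evalG I F) (⊢-sound v≤2 Γ≥v d)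
  ⊢-sound v≤2 Γ≥v (∨E {F} {G} d e f) with ⊔-sel (evalG I F) (evalG I G)
  ... | inj₁ F⊔G≡F = ⊢-sound v≤2 (subst (_ ≤_) F⊔G≡F (⊢-sound v≤2 Γ≥v d) ∷ Γ≥v) e
  ... | inj₂ F⊔G≡G = ⊢-sound v≤2 (subst (_ ≤_) F⊔G≡G (⊢-sound v≤2 Γ≥v d) ∷ Γ≥v) f
  ⊢-sound {v = v} v≤2 Γ≥v (⇐I {B = B} d) =
    ⇐-intro v≤2 (⊢-sound (≤-trans v⊓B≤v v≤2) (m⊓n≤n v (evalG I B) ∷ All.map (≤-trans v⊓B≤v) Γ≥v) d)
    where
    v⊓B≤v : v ⊓ evalG I B ≤ v
    v⊓B≤v = m⊓n≤m v (evalG I B)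
  ⊢-sound v≤2 Γ≥v (⇐E d e) = ⇐-elim (⊢-sound v≤2 Γ≥v d) (⊢-sound v≤2 Γ≥v e)
  ⊢-sound v≤2 Γ≥v (⊥E d) with ⊢-sound v≤2 Γ≥v d
  ... | z≤n = z≤n

infix 4 _⊨_

_⊨_ : (Atom → V) → List Formula → Set
J ⊨ Γ = All (λ F → evalV J F ≡ v2) Γ

_⊨?_ : ∀ J Γ → Dec (J ⊨ Γ)
J ⊨? Γ = All.all? (λ F → evalV J F ≟ᵥ v2) Γ

⊢-sound-⊨ : ∀ {J} → J ⊨ Γ → Γ ⊢ φ → evalV J φ ≡ v2
⊢-sound-⊨ {φ = φ} {J = J} J⊨Γ d =
  2≤toℕ⇒v2 (subst (2 ≤_) (evalG-toℕ∘ J φ)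
    (⊢-sound (toℕ ∘ J) ≤-refl (All.map (λ {ψ} → 2≤eval {ψ}) J⊨Γ) d))
  where
  2≤eval : ∀ {ψ} → evalV J ψ ≡ v2 → 2 ≤ evalG (toℕ ∘ J) ψ
  2≤eval {ψ} ψ≡v2 = ≤-reflexive (sym (trans (evalG-toℕ∘ J ψ) (cong toℕ ψ≡v2)))

⊢-weaken : Γ ⊆ Δ → Γ ⊢ φ → Δ ⊢ φ
⊢-weaken Γ⊆Δ (hyp p)    = hyp (Γ⊆Δ p)
⊢-weaken Γ⊆Δ (∧I d e)   = ∧I (⊢-weaken Γ⊆Δ d) (⊢-weaken Γ⊆Δ e)
⊢-weaken Γ⊆Δ (∧E₁ d)    = ∧E₁ (⊢-weaken Γ⊆Δ d)
⊢-weaken Γ⊆Δ (∧E₂ d)    = ∧E₂ (⊢-weaken Γ⊆Δ d)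
⊢-weaken Γ⊆Δ (∨I₁ d)    = ∨I₁ (⊢-weaken Γ⊆Δ d)
⊢-weaken Γ⊆Δ (∨I₂ d)    = ∨I₂ (⊢-weaken Γ⊆Δ d)
⊢-weaken Γ⊆Δ (∨E d e f) = ∨E (⊢-weaken Γ⊆Δ d) (⊢-weaken (∷⁺ʳ _ Γ⊆Δ) e) (⊢-weaken (∷⁺ʳ _ Γ⊆Δ) f)
⊢-weaken Γ⊆Δ (⇐I d)     = ⇐I (⊢-weaken (∷⁺ʳ _ Γ⊆Δ) d)
⊢-weaken Γ⊆Δ (⇐E d e)   = ⇐E (⊢-weaken Γ⊆Δ d) (⊢-weaken Γ⊆Δ e)
⊢-weaken Γ⊆Δ (⊥E d)     = ⊥E (⊢-weaken Γ⊆Δ d)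

wk : Γ ⊢ φ → (ψ ∷ Γ) ⊢ φ
wk = ⊢-weaken there

var₀ : (φ ∷ Γ) ⊢ φ
var₀ = hyp (here refl)

⇐-const : Γ ⊢ φ → Γ ⊢ φ ⇐ ψ
⇐-const d = ⇐I (wk d)

⇐-comp : Γ ⊢ χ ⇐ ψ → Γ ⊢ ψ ⇐ φ → Γ ⊢ χ ⇐ φ
⇐-comp g f = ⇐I (⇐E (wk g) (⇐E (wk f) var₀))

⊥⇒ : Γ ⊢ φ ⇐ ⊥f
⊥⇒ = ⇐I (⊥E var₀)

⇐-K : Γ ⊢ (φ ⇐ ψ) ⇐ φ
⇐-K = ⇐I (⇐-const var₀)

⇐-precomp : Γ ⊢ ψ ⇐ φ → Γ ⊢ (χ ⇐ φ) ⇐ (χ ⇐ ψ)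
⇐-precomp f = ⇐I (⇐-comp var₀ (wk f))

⇐-postcomp : Γ ⊢ ψ ⇐ φ → Γ ⊢ (ψ ⇐ χ) ⇐ (φ ⇐ χ)
⇐-postcomp f = ⇐I (⇐-comp (wk f) var₀)

∧-proj₁ : Γ ⊢ φ ⇐ (φ ∧f ψ)
∧-proj₁ = ⇐I (∧E₁ var₀)

∧-proj₂ : Γ ⊢ ψ ⇐ (φ ∧f ψ)
∧-proj₂ = ⇐I (∧E₂ var₀)

∨-inj₁ : Γ ⊢ (φ ∨f ψ) ⇐ φ
∨-inj₁ = ⇐I (∨I₁ var₀)

∨-inj₂ : Γ ⊢ (φ ∨f ψ) ⇐ ψ
∨-inj₂ = ⇐I (∨I₂ var₀)

⇐-pair : Γ ⊢ φ ⇐ χ → Γ ⊢ ψ ⇐ χ → Γ ⊢ (φ ∧f ψ) ⇐ χ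
⇐-pair f g = ⇐I (∧I (⇐E (wk f) var₀) (⇐E (wk g) var₀))

⇐-cases : Γ ⊢ χ ⇐ φ → Γ ⊢ χ ⇐ ψ → Γ ⊢ χ ⇐ (φ ∨f ψ)
⇐-cases f g = ⇐I (∨E var₀ (⇐E (wk (wk f)) var₀) (⇐E (wk (wk g)) var₀))

¬[_]_ : Formula → Formula → Formula
¬[ χ ] φ = χ ⇐ φ

dn-unit : Γ ⊢ φ → Γ ⊢ ¬[ χ ] ¬[ χ ] φ
dn-unit d = ⇐I (⇐E var₀ (wk d))

dn-map : Γ ⊢ ψ ⇐ φ → Γ ⊢ ¬[ χ ] ¬[ χ ] φ → Γ ⊢ ¬[ χ ] ¬[ χ ] ψ
dn-map f d = ⇐-comp d (⇐-precomp f)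

dn-pair : Γ ⊢ ¬[ χ ] ¬[ χ ] φ → Γ ⊢ ¬[ χ ] ¬[ χ ] ψ → Γ ⊢ ¬[ χ ] ¬[ χ ] (φ ∧f ψ)
dn-pair d e = ⇐I (⇐E (wk d) (⇐I (⇐E (wk (wk e)) (⇐I (⇐E var₂ (∧I var₁ var₀))))))
  where
  var₁ : (φ ∷ ψ ∷ Γ) ⊢ ψ
  var₁ = wk var₀
  var₂ : (φ ∷ ψ ∷ χ ∷ Γ) ⊢ χ
  var₂ = wk (wk var₀)

refute-⇐ : Γ ⊢ ¬[ χ ] ¬[ χ ] ψ → Γ ⊢ ¬[ χ ] φ → Γ ⊢ ¬[ χ ] (φ ⇐ ψ)
refute-⇐ dnψ ¬φ = ⇐-comp dnψ (⇐-postcomp ¬φ)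

-- A logical relation between G₃ and formulas over Γ in which the value 1 stands for G.
-- Provided Γ ⊢ ¬¬G it is preserved by every connective.
Valued : List Formula → Formula → V → Formula → Set
Valued Γ G v0 φ = Γ ⊢ ¬f φ
Valued Γ G v1 φ = (Γ ⊢ φ ⇐ G) × (Γ ⊢ ¬[ G ] φ)
Valued Γ G v2 φ = (Γ ⊢ φ ⇐ G) × (Γ ⊢ ¬[ G ] ¬[ G ] φ)

module _ {G : Formula} where

  valued-⊢ : Γ ⊢ φ → Valued Γ G v2 φ
  valued-⊢ d = ⇐-const d , dn-unit d

  valued-∧ : ∀ v w → Valued Γ G v φ → Valued Γ G w ψ → Valued Γ G (v ⊓ᵥ w) (φ ∧f ψ)
  valued-∧ v0 _  r _ = ⇐-comp r ∧-proj₁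
  valued-∧ v1 v0 _ s = ⇐-comp s ∧-proj₂
  valued-∧ v2 v0 _ s = ⇐-comp s ∧-proj₂
  valued-∧ v1 v1 (f , g) (f′ , _)  = ⇐-pair f f′ , ⇐-comp g ∧-proj₁
  valued-∧ v1 v2 (f , g) (f′ , _)  = ⇐-pair f f′ , ⇐-comp g ∧-proj₁
  valued-∧ v2 v1 (f , _) (f′ , g′) = ⇐-pair f f′ , ⇐-comp g′ ∧-proj₂
  valued-∧ v2 v2 (f , d) (f′ , d′) = ⇐-pair f f′ , dn-pair d d′

  valued-∨ : ∀ v w → Valued Γ G v φ → Valued Γ G w ψ → Valued Γ G (v ⊔ᵥ w) (φ ∨f ψ)
  valued-∨ v0 v0 r s             = ⇐-cases r s
  valued-∨ v0 v1 r (f , g)       = ⇐-comp ∨-inj₂ f , ⇐-cases (⇐-comp ⊥⇒ r) g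
  valued-∨ v1 v0 (f , g) s       = ⇐-comp ∨-inj₁ f , ⇐-cases g (⇐-comp ⊥⇒ s)
  valued-∨ v1 v1 (f , g) (_ , g′) = ⇐-comp ∨-inj₁ f , ⇐-cases g g′
  valued-∨ v0 v2 _ (f , d)       = ⇐-comp ∨-inj₂ f , dn-map ∨-inj₂ d
  valued-∨ v1 v2 _ (f , d)       = ⇐-comp ∨-inj₂ f , dn-map ∨-inj₂ d
  valued-∨ v2 _  (f , d) _       = ⇐-comp ∨-inj₁ f , dn-map ∨-inj₁ d

  valued-⇐ : Γ ⊢ ¬f ¬f G → ∀ h b → Valued Γ G h φ → Valued Γ G b ψ → Valued Γ G (h ⇐ᵥ b) (φ ⇐ ψ)
  valued-⇐ _   _  v0 _ s               = valued-⊢ (⇐-comp ⊥⇒ s)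
  valued-⇐ ¬¬G v0 v1 r (f′ , _)        = refute-⇐ (dn-map f′ ¬¬G) r
  valued-⇐ ¬¬G v0 v2 r (f′ , _)        = refute-⇐ (dn-map f′ ¬¬G) r
  valued-⇐ _   v1 v1 (f , _) (_ , g′)  = valued-⊢ (⇐-comp f g′)
  valued-⇐ _   v2 v1 (f , _) (_ , g′)  = valued-⊢ (⇐-comp f g′)
  valued-⇐ _   v1 v2 (f , g) (_ , d′)  = ⇐-comp ⇐-K f , refute-⇐ d′ g
  valued-⇐ _   v2 v2 (f , d) _         = ⇐-comp ⇐-K f , dn-map ⇐-K d

  valued : Γ ⊢ ¬f ¬f G → ∀ J φ → (∀ {a} → a ∈ atomsF φ → Valued Γ G (J a) (atom a)) →
           Valued Γ G (evalV J φ) φ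
  valued _ J (atom a) atoms = atoms (here refl)
  valued _ J ⊥f       _     = ⇐I var₀
  valued ¬¬G J (φ ∧f ψ) atoms =
    valued-∧ (evalV J φ) (evalV J ψ)
      (valued ¬¬G J φ (atoms ∘′ ∈-++⁺ˡ)) (valued ¬¬G J ψ (atoms ∘′ ∈-++⁺ʳ (atomsF φ)))
  valued ¬¬G J (φ ∨f ψ) atoms =
    valued-∨ (evalV J φ) (evalV J ψ)
      (valued ¬¬G J φ (atoms ∘′ ∈-++⁺ˡ)) (valued ¬¬G J ψ (atoms ∘′ ∈-++⁺ʳ (atomsF φ)))
  valued ¬¬G J (φ ⇐ ψ) atoms =
    valued-⇐ ¬¬G (evalV J φ) (evalV J ψ)
      (valued ¬¬G J φ (atoms ∘′ ∈-++⁺ˡ)) (valued ¬¬G J ψ (atoms ∘′ ∈-++⁺ʳ (atomsF φ)))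

  valued⇒⊢G : ∀ {v} → Valued Γ G v φ → v ≢ v2 → Γ ⊢ φ → Γ ⊢ G
  valued⇒⊢G {v = v0} ¬φ     _     d = ⊥E (⇐E ¬φ d)
  valued⇒⊢G {v = v1} (_ , g) _     d = ⇐E g d
  valued⇒⊢G {v = v2} _      v≢v2 _ = contradiction refl v≢v2

-- Classical models as two-valued G₃-models

positive : V → Bool
positive v0 = false
positive _  = true

positive-⊓ : ∀ x y → positive (x ⊓ᵥ y) ≡ positive x ∧ positive y
positive-⊓ v0 _  = refl
positive-⊓ v1 v0 = refl
positive-⊓ v1 v1 = refl
positive-⊓ v1 v2 = refl
positive-⊓ v2 _  = refl

positive-⊔ : ∀ x y → positive (x ⊔ᵥ y) ≡ positive x ∨ positive y
positive-⊔ v0 _  = refl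
positive-⊔ v1 v0 = refl
positive-⊔ v1 v1 = refl
positive-⊔ v1 v2 = refl
positive-⊔ v2 _  = refl

positive-⇐ : ∀ h b → positive (h ⇐ᵥ b) ≡ (if positive b then positive h else true)
positive-⇐ _  v0 = refl
positive-⇐ v0 v1 = refl
positive-⇐ v0 v2 = refl
positive-⇐ v1 v1 = refl
positive-⇐ v1 v2 = refl
positive-⇐ v2 v1 = refl
positive-⇐ v2 v2 = refl

collapse : V → V
collapse v0 = v0
collapse _  = v2

collapse-⊓ : ∀ x y → collapse (x ⊓ᵥ y) ≡ collapse x ⊓ᵥ collapse y
collapse-⊓ v0 _  = refl
collapse-⊓ v1 v0 = refl
collapse-⊓ v1 v1 = refl
collapse-⊓ v1 v2 = refl
collapse-⊓ v2 _  = refl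

collapse-⊔ : ∀ x y → collapse (x ⊔ᵥ y) ≡ collapse x ⊔ᵥ collapse y
collapse-⊔ v0 _  = refl
collapse-⊔ v1 v0 = refl
collapse-⊔ v1 v1 = refl
collapse-⊔ v1 v2 = refl
collapse-⊔ v2 _  = refl

collapse-⇐ : ∀ h b → collapse (h ⇐ᵥ b) ≡ collapse h ⇐ᵥ collapse b
collapse-⇐ _  v0 = refl
collapse-⇐ v0 v1 = refl
collapse-⇐ v0 v2 = refl
collapse-⇐ v1 v1 = refl
collapse-⇐ v1 v2 = refl
collapse-⇐ v2 v1 = refl
collapse-⇐ v2 v2 = refl

positive⇒collapse≡v2 : ∀ {x} → positive x ≡ true → collapse x ≡ v2
positive⇒collapse≡v2 {v1} _ = refl
positive⇒collapse≡v2 {v2} _ = refl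

¬¬-positive : ∀ {x} → x ≢ v0 → v0 ⇐ᵥ (v0 ⇐ᵥ x) ≡ v2
¬¬-positive {v0} x≢v0 = contradiction refl x≢v0
¬¬-positive {v1} _    = refl
¬¬-positive {v2} _    = refl

⇐ᵥ-pinned : ∀ {x} → v1 ⇐ᵥ x ≡ v2 → x ⇐ᵥ v1 ≡ v2 → x ≡ v1
⇐ᵥ-pinned {v1} _ _ = refl
⇐ᵥ-pinned {v0} _ ()
⇐ᵥ-pinned {v2} () _

¬positive⇒v0 : ∀ {x} → positive x ≡ false → x ≡ v0
¬positive⇒v0 {v0} _ = refl

evalV-local : ∀ {J J′} φ → (∀ {a} → a ∈ atomsF φ → J a ≡ J′ a) → evalV J φ ≡ evalV J′ φ
evalV-local (atom a) J≡J′ = J≡J′ (here refl)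
evalV-local ⊥f       _    = refl
evalV-local (φ ∧f ψ) J≡J′ =
  cong₂ _⊓ᵥ_ (evalV-local φ (J≡J′ ∘′ ∈-++⁺ˡ)) (evalV-local ψ (J≡J′ ∘′ ∈-++⁺ʳ (atomsF φ)))
evalV-local (φ ∨f ψ) J≡J′ =
  cong₂ _⊔ᵥ_ (evalV-local φ (J≡J′ ∘′ ∈-++⁺ˡ)) (evalV-local ψ (J≡J′ ∘′ ∈-++⁺ʳ (atomsF φ)))
evalV-local (φ ⇐ ψ)  J≡J′ =
  cong₂ _⇐ᵥ_ (evalV-local φ (J≡J′ ∘′ ∈-++⁺ˡ)) (evalV-local ψ (J≡J′ ∘′ ∈-++⁺ʳ (atomsF φ)))

⊨-local : ∀ {J J′ Q} → (∀ {F} → F ∈ Q → evalV J F ≡ evalV J′ F) → J ⊨ Q → J′ ⊨ Q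
⊨-local J≡J′ J⊨Q = All.tabulate λ F∈Q → trans (sym (J≡J′ F∈Q)) (All.lookup J⊨Q F∈Q)

⊨-cong : ∀ {J J′ Q} → J ≗ J′ → J ⊨ Q → J′ ⊨ Q
⊨-cong J≗J′ = ⊨-local λ {F} _ → evalV-local F λ {a} _ → J≗J′ a

evalV-collapse : ∀ J φ → evalV (collapse ∘ J) φ ≡ collapse (evalV J φ)
evalV-collapse J (atom a) = refl
evalV-collapse J ⊥f       = refl
evalV-collapse J (φ ∧f ψ) rewrite evalV-collapse J φ | evalV-collapse J ψ =
  sym (collapse-⊓ (evalV J φ) (evalV J ψ))
evalV-collapse J (φ ∨f ψ) rewrite evalV-collapse J φ | evalV-collapse J ψ =
  sym (collapse-⊔ (evalV J φ) (evalV J ψ))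
evalV-collapse J (φ ⇐ ψ)  rewrite evalV-collapse J φ | evalV-collapse J ψ =
  sym (collapse-⇐ (evalV J φ) (evalV J ψ))

Support : (Atom → V) → List Atom → Set
Support J M = ∀ a → positive (J a) ≡ does (a ∈? M)

evalC-positive : ∀ {J M} → Support J M → ∀ φ → evalC M φ ≡ positive (evalV J φ)
evalC-positive sJ (atom a) = sym (sJ a)
evalC-positive sJ ⊥f       = refl
evalC-positive {J} sJ (φ ∧f ψ) =
  trans (cong₂ _∧_ (evalC-positive sJ φ) (evalC-positive sJ ψ)) (sym (positive-⊓ (evalV J φ) (evalV J ψ)))
evalC-positive {J} sJ (φ ∨f ψ) =
  trans (cong₂ _∨_ (evalC-positive sJ φ) (evalC-positive sJ ψ)) (sym (positive-⊔ (evalV J φ) (evalV J ψ)))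
evalC-positive {J} sJ (φ ⇐ ψ) =
  trans (cong₂ (λ h b → if b then h else true) (evalC-positive sJ φ) (evalC-positive sJ ψ))
        (sym (positive-⇐ (evalV J φ) (evalV J ψ)))

support-∉ : ∀ {J M a} → Support J M → a ∉ M → J a ≡ v0
support-∉ {M = M} {a} sJ a∉M = ¬positive⇒v0 (trans (sJ a) (dec-false (a ∈? M) a∉M))

support-∈ : ∀ {J M a} → Support J M → a ∈ M → J a ≢ v0
support-∈ {M = M} {a} sJ a∈M Ja≡v0
  with () ← trans (sym (cong positive Ja≡v0)) (trans (sJ a) (dec-true (a ∈? M) a∈M))

⌜_⌝ : List Atom → Atom → V
⌜ M ⌝ a = if does (a ∈? M) then v2 else v0

support-⌜⌝ : ∀ M → Support ⌜ M ⌝ M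
support-⌜⌝ M a with does (a ∈? M)
... | true  = refl
... | false = refl

support-two-valued : ∀ {J M} → Support J M → (∀ {a} → a ∈ M → J a ≡ v2) → J ≗ ⌜ M ⌝
support-two-valued {M = M} sJ J≡v2 a with a ∈? M
... | yes a∈M = J≡v2 a∈M
... | no  a∉M = support-∉ sJ a∉M

⊨⇒model : ∀ {J M Q} → Support J M → J ⊨ Q → IsModel Q M
⊨⇒model sJ = All.map (λ {F} F≡v2 → trans (evalC-positive sJ F) (cong positive F≡v2))

model⇒⌜⌝⊨ : ∀ {M Q} → IsModel Q M → ⌜ M ⌝ ⊨ Q
model⇒⌜⌝⊨ {M} = All.map λ {F} → true⇒v2 F
  where
  collapse-⌜⌝ : ∀ a → collapse (⌜ M ⌝ a) ≡ ⌜ M ⌝ a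
  collapse-⌜⌝ a with does (a ∈? M)
  ... | true  = refl
  ... | false = refl
  true⇒v2 : ∀ F → evalC M F ≡ true → evalV ⌜ M ⌝ F ≡ v2
  true⇒v2 F F-true = begin
    evalV ⌜ M ⌝ F              ≡⟨ evalV-local F (λ {a} _ → sym (collapse-⌜⌝ a)) ⟩
    evalV (collapse ∘ ⌜ M ⌝) F ≡⟨ evalV-collapse ⌜ M ⌝ F ⟩
    collapse (evalV ⌜ M ⌝ F)   ≡⟨ positive⇒collapse≡v2 positive-F ⟩
    v2                         ∎
    where
    positive-F : positive (evalV ⌜ M ⌝ F) ≡ true
    positive-F = trans (sym (evalC-positive (support-⌜⌝ M) F)) F-true

-- G₃-consequence as inclusion of G₃-models

⊓ᵥ≡v2 : ∀ {x y} → x ⊓ᵥ y ≡ v2 → x ≡ v2 × y ≡ v2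
⊓ᵥ≡v2 {v2} {v2} _ = refl , refl
⊓ᵥ≡v2 {v0}      ()
⊓ᵥ≡v2 {v1} {v0} ()
⊓ᵥ≡v2 {v1} {v1} ()
⊓ᵥ≡v2 {v1} {v2} ()
⊓ᵥ≡v2 {v2} {v0} ()
⊓ᵥ≡v2 {v2} {v1} ()

⇐ᵥ-mp : ∀ {h b} → b ≡ v2 → h ⇐ᵥ b ≡ v2 → h ≡ v2
⇐ᵥ-mp {v2} refl _ = refl
⇐ᵥ-mp {v0} refl ()
⇐ᵥ-mp {v1} refl ()

⇐ᵥ-valid : ∀ h b → (b ≡ v2 → h ≡ v2) → (collapse b ≡ v2 → collapse h ≡ v2) → h ⇐ᵥ b ≡ v2
⇐ᵥ-valid _  v0 _ _ = refl
⇐ᵥ-valid v0 v1 _ c with () ← c refl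
⇐ᵥ-valid v1 v1 _ _ = refl
⇐ᵥ-valid v2 v1 _ _ = refl
⇐ᵥ-valid h  v2 t _ rewrite t refl = refl

⊨⇒conj : ∀ {J} Fs → J ⊨ Fs → evalV J (conj Fs) ≡ v2
⊨⇒conj []               _                 = refl
⊨⇒conj (F ∷ [])         (F≡v2 ∷ [])       = F≡v2
⊨⇒conj (F ∷ Fs@(_ ∷ _)) (F≡v2 ∷ J⊨Fs) rewrite F≡v2 | ⊨⇒conj Fs J⊨Fs = refl

conj⇒⊨ : ∀ {J} Fs → evalV J (conj Fs) ≡ v2 → J ⊨ Fs
conj⇒⊨ []               _ = []
conj⇒⊨ (F ∷ [])         F≡v2 = F≡v2 ∷ []
conj⇒⊨ {J} (F ∷ Fs@(_ ∷ _)) F∧Fs≡v2 =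
  let F≡v2 , Fs≡v2 = ⊓ᵥ≡v2 {evalV J F} F∧Fs≡v2 in F≡v2 ∷ conj⇒⊨ Fs Fs≡v2

infix 4 _⊨₃_

_⊨₃_ : Program → Program → Set
P₁ ⊨₃ P₂ = ∀ J → J ⊨ P₁ → J ⊨ P₂

⊢G3⇒⊨₃ : ∀ {P₁ P₂} → All (P₁ ⊢G3_) P₂ → P₁ ⊨₃ P₂
⊢G3⇒⊨₃ {P₁} P₁⊢P₂ J J⊨P₁ = All.map (λ {F} → entailed {F}) P₁⊢P₂
  where
  entailed : ∀ {F} → P₁ ⊢G3 F → evalV J F ≡ v2
  entailed {F} (Fs , Fs⊆P₁ , valid) =
    ⇐ᵥ-mp (⊨⇒conj Fs (All.map (All.lookup J⊨P₁) Fs⊆P₁)) (Equivalence.to (G3Valid⇔ (F ⇐ conj Fs)) valid J)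

-- If conj P₁ has value 1 under J then it has value 2 under collapse ∘ J, hence so does F,
-- and the value of F under J is not 0.
⊨₃⇒⊢G3 : ∀ {P₁ P₂} → P₁ ⊨₃ P₂ → All (P₁ ⊢G3_) P₂
⊨₃⇒⊢G3 {P₁} {P₂} P₁⊨P₂ = All.tabulate λ {F} F∈P₂ →
  P₁ , All.tabulate id , Equivalence.from (G3Valid⇔ (F ⇐ conj P₁)) λ J →
    ⇐ᵥ-valid (evalV J F) (evalV J (conj P₁)) (entailed J F∈P₂) (entailed-collapse J F∈P₂)
  where
  entailed : ∀ J {F} → F ∈ P₂ → evalV J (conj P₁) ≡ v2 → evalV J F ≡ v2
  entailed J F∈P₂ P₁≡v2 = All.lookup (P₁⊨P₂ J (conj⇒⊨ P₁ P₁≡v2)) F∈P₂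
  entailed-collapse : ∀ J {F} → F ∈ P₂ → collapse (evalV J (conj P₁)) ≡ v2 → collapse (evalV J F) ≡ v2
  entailed-collapse J {F} F∈P₂ P₁≡v2 =
    trans (sym (evalV-collapse J F))
          (entailed (collapse ∘ J) F∈P₂ (trans (evalV-collapse J (conj P₁)) P₁≡v2))

-- Answer sets as equilibrium models

atomsF⊆σ : ∀ {F Q} → F ∈ Q → atomsF F ⊆ σ Q
atomsF⊆σ {Q = F ∷ _} (here refl) = ∈-++⁺ˡ
atomsF⊆σ {Q = G ∷ _} (there F∈Q) = ∈-++⁺ʳ (atomsF G) ∘′ atomsF⊆σ F∈Q

module _ {Q : Program} {M : List Atom} where

  ∈-completion-¬ : ∀ {a} → a ∈ σ Q → a ∉ M → ¬f atom a ∈ completion Q M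
  ∈-completion-¬ a∈σ a∉M =
    ∈-++⁺ʳ Q (∈-++⁺ˡ (∈-map⁺ (λ a → ¬f atom a) (∈-filter⁺ (λ a → ¬? (a ∈? M)) a∈σ a∉M)))

  ∈-completion-¬¬ : ∀ {a} → a ∈ M → ¬f ¬f atom a ∈ completion Q M
  ∈-completion-¬¬ a∈M = ∈-++⁺ʳ Q (∈-++⁺ʳ _ (∈-map⁺ (λ a → ¬f ¬f atom a) a∈M))

  completion-sound : ∀ {J} → Support J M → J ⊨ Q → J ⊨ completion Q M
  completion-sound {J} sJ J⊨Q =
    AllP.++⁺ J⊨Q (AllP.++⁺ (AllP.map⁺ (All.tabulate refuted)) (AllP.map⁺ (All.tabulate double-negated)))
    where
    refuted : ∀ {a} → a ∈ filter (λ a → ¬? (a ∈? M)) (σ Q) → v0 ⇐ᵥ J a ≡ v2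
    refuted a∈ rewrite support-∉ sJ (proj₂ (∈-filter⁻ (λ a → ¬? (a ∈? M)) {xs = σ Q} a∈)) = refl
    double-negated : ∀ {a} → a ∈ M → v0 ⇐ᵥ (v0 ⇐ᵥ J a) ≡ v2
    double-negated {a} a∈M with J a | support-∈ sJ a∈M
    ... | v0 | Ja≢v0 = contradiction refl Ja≢v0
    ... | v1 | _     = refl
    ... | v2 | _     = refl

-- Pearce's equilibrium condition, read in G₃.
Equilibrium : Program → List Atom → Set
Equilibrium Q M = ∀ J → Support J M → J ⊨ Q → ∀ {a} → a ∈ M → J a ≡ v2

answerSet⇒equilibrium : ∀ {Q M} → IsAnswerSet Q M → Equilibrium Q M
answerSet⇒equilibrium (_ , proves) J sJ J⊨Q a∈M = ⊢-sound-⊨ (completion-sound sJ J⊨Q) (proves _ a∈M)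

model⇒consistent : ∀ {Q M} → IsModel Q M → ¬ (completion Q M ⊢ ⊥f)
model⇒consistent {M = M} model ⊢⊥
  with () ← ⊢-sound-⊨ (completion-sound (support-⌜⌝ M) (model⇒⌜⌝⊨ model)) ⊢⊥

⋀ : List Atom → Formula
⋀ []       = ⊤f
⋀ (a ∷ as) = atom a ∧f ⋀ as

⋀-intro : ∀ {Γ} M → (∀ {a} → a ∈ M → Γ ⊢ atom a) → Γ ⊢ ⋀ M
⋀-intro []      _    = ⇐I var₀
⋀-intro (a ∷ M) ⊢M = ∧I (⊢M (here refl)) (⋀-intro M (⊢M ∘′ there))

⋀-elim : ∀ {Γ a} M → Γ ⊢ ⋀ M → a ∈ M → Γ ⊢ atom a
⋀-elim (_ ∷ M) ⊢M (here refl) = ∧E₁ ⊢M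
⋀-elim (_ ∷ M) ⊢M (there a∈M) = ⋀-elim M (∧E₂ ⊢M) a∈M

¬¬⋀ : ∀ {Γ} M → (∀ {a} → a ∈ M → Γ ⊢ ¬f ¬f atom a) → Γ ⊢ ¬f ¬f ⋀ M
¬¬⋀ []      _     = dn-unit (⇐I var₀)
¬¬⋀ (a ∷ M) ⊢¬¬M = dn-pair (⊢¬¬M (here refl)) (¬¬⋀ M (⊢¬¬M ∘′ there))

module _ {Q : Program} {M : List Atom} (equilibrium : Equilibrium Q M) where

  private
    J[_] : List Atom → Atom → V
    J[ D ] a = if does (a ∈? M) then (if does (a ∈? D) then v1 else v2) else v0

    support-J : ∀ D → Support J[ D ] M
    support-J D a with a ∈? M | a ∈? D
    ... | yes _ | yes _ = refl
    ... | yes _ | no  _ = refl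
    ... | no  _ | _     = refl

    J≢v2 : ∀ {D b} → b ∈ D → J[ D ] b ≢ v2
    J≢v2 {D} {b} b∈D with b ∈? M | b ∈? D
    ... | yes _ | yes _   = λ ()
    ... | yes _ | no  b∉D = contradiction b∈D b∉D
    ... | no  _ | _       = λ ()

    _─_ : List Atom → Atom → List Atom
    D ─ a = filter (λ b → ¬? (b ≟ a)) D

    Derivable : List Atom → Set
    Derivable D = ∀ {Γ} → completion Q M ⊆ Γ → (∀ {b} → b ∈ M → b ∉ D → Γ ⊢ atom b) → Γ ⊢ ⋀ M

    -- If some formula F of Q is not valued 2 by J[ D ], the relation Valued turns the
    -- derivation of F into one of ⋀ M, given derivations of ⋀ M from each atom of D.
    derivable : ∀ D → Acc (_<_ on length) D → Derivable D
    derivable D (acc smaller) {Γ} compl⊆Γ known with J[ D ] ⊨? Q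
    ... | yes J⊨Q =
      ⋀-intro M λ b∈M → known b∈M λ b∈D → J≢v2 b∈D (equilibrium J[ D ] (support-J D) J⊨Q b∈M)
    ... | no  J⊭Q with F , F∈Q , F≢v2 ← find (¬All⇒Any¬ (λ F → evalV J[ D ] F ≟ᵥ v2) Q J⊭Q) =
      valued⇒⊢G (valued ¬¬⋀M J[ D ] F atom-valued) F≢v2 (hyp (compl⊆Γ (∈-++⁺ˡ F∈Q)))
      where
      ¬¬⋀M : Γ ⊢ ¬f ¬f ⋀ M
      ¬¬⋀M = ¬¬⋀ M (hyp ∘′ compl⊆Γ ∘′ ∈-completion-¬¬ {Q})
      shorter : ∀ {a} → a ∈ D → length (D ─ a) < length D
      shorter {a} a∈D = filter-notAll (λ b → ¬? (b ≟ a)) D (Any.map (λ a≡b b≢a → b≢a (sym a≡b)) a∈D)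
      atom-valued : ∀ {a} → a ∈ atomsF F → Valued Γ (⋀ M) (J[ D ] a) (atom a)
      atom-valued {a} a∈F with a ∈? M | a ∈? D
      ... | no  a∉M | _       = hyp (compl⊆Γ (∈-completion-¬ {Q} (atomsF⊆σ F∈Q a∈F) a∉M))
      ... | yes a∈M | no  a∉D = valued-⊢ (known a∈M a∉D)
      ... | yes a∈M | yes a∈D =
        ⇐I (⋀-elim M var₀ a∈M) , ⇐I (derivable (D ─ a) (smaller (shorter a∈D)) (there ∘′ compl⊆Γ) known′)
        where
        known′ : ∀ {b} → b ∈ M → b ∉ D ─ a → (atom a ∷ Γ) ⊢ atom b
        known′ {b} b∈M b∉D─a with b ≟ a
        ... | yes refl = var₀
        ... | no  b≢a  = wk (known b∈M λ b∈D → b∉D─a (∈-filter⁺ (λ b → ¬? (b ≟ a)) b∈D b≢a))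

  equilibrium⇒proves : ∀ {a} → a ∈ M → completion Q M ⊢ atom a
  equilibrium⇒proves =
    ⋀-elim M (derivable M (On.wellFounded length <-wellFounded M) id (λ b∈M b∉M → contradiction b∈M b∉M))

minAnswerSet⇔ : ∀ {Q M} → IsMinAnswerSet Q M ⇔ (IsMinimalModel Q M × Equilibrium Q M)
minAnswerSet⇔ = mk⇔
  (λ (answerSet , minimal) → minimal , answerSet⇒equilibrium answerSet)
  (λ (minimal , equilibrium) →
    (model⇒consistent (proj₁ minimal) , λ _ → equilibrium⇒proves equilibrium) , minimal)

⊨₃-++ : ∀ {P₁ P₂} → P₁ ⊨₃ P₂ → ∀ P → P₁ ++ P ⊨₃ P₂ ++ P
⊨₃-++ {P₁} P₁⊨P₂ P J J⊨P₁P = AllP.++⁺ (P₁⊨P₂ J (AllP.++⁻ˡ P₁ J⊨P₁P)) (AllP.++⁻ʳ P₁ J⊨P₁P)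

⊨₃⇒models : ∀ {Q₁ Q₂ M} → Q₁ ⊨₃ Q₂ → IsModel Q₁ M → IsModel Q₂ M
⊨₃⇒models {M = M} Q₁⊨Q₂ model = ⊨⇒model (support-⌜⌝ M) (Q₁⊨Q₂ ⌜ M ⌝ (model⇒⌜⌝⊨ model))

minAnswerSet-transfer : ∀ {Q₁ Q₂ M} → Q₁ ⊨₃ Q₂ → Q₂ ⊨₃ Q₁ → IsMinAnswerSet Q₁ M → IsMinAnswerSet Q₂ M
minAnswerSet-transfer Q₁⊨Q₂ Q₂⊨Q₁ minAnswerSet
  with (model , minimal) , equilibrium ← Equivalence.to minAnswerSet⇔ minAnswerSet =
  Equivalence.from minAnswerSet⇔
    ( (⊨₃⇒models Q₁⊨Q₂ model , λ M′ M′⊆M M⊈M′ → minimal M′ M′⊆M M⊈M′ ∘′ ⊨₃⇒models Q₂⊨Q₁)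
    , λ J sJ J⊨Q₂ → equilibrium J sJ (Q₂⊨Q₁ J J⊨Q₂) )

minimal-if-forced : ∀ {Q M} → IsModel Q M → (∀ {M′} → IsModel Q M′ → M ⊆ M′) → IsMinimalModel Q M
minimal-if-forced model forced = model , λ _ _ M⊈M′ model′ → M⊈M′ (forced model′)

facts : List Atom → Program
facts = map atom

facts-model⇒⊆ : ∀ {M M′} → IsModel (facts M) M′ → M ⊆ M′
facts-model⇒⊆ {M′ = M′} model {a} a∈M with a ∈? M′ | All.lookup (AllP.map⁻ model) a∈M
... | yes a∈M′ | _ = a∈M′

¬¬-model⇒⊆ : ∀ {M M′} → IsModel (map (λ a → ¬f ¬f atom a) M) M′ → M ⊆ M′
¬¬-model⇒⊆ {M′ = M′} model {a} a∈M with a ∈? M′ | All.lookup (AllP.map⁻ model) a∈M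
... | yes a∈M′ | _ = a∈M′

facts-minAnswerSet : ∀ {Q M} → IsModel Q M → IsMinAnswerSet (Q ++ facts M) M
facts-minAnswerSet {Q} {M} model = Equivalence.from minAnswerSet⇔
  ( minimal-if-forced (AllP.++⁺ model facts-true) (facts-model⇒⊆ ∘′ AllP.++⁻ʳ Q)
  , λ _ _ J⊨QM → All.lookup (AllP.map⁻ (AllP.++⁻ʳ Q J⊨QM)) )
  where
  facts-true : IsModel (facts M) M
  facts-true = AllP.map⁺ (All.tabulate (dec-true (_ ∈? M)))

module Pin {J : Atom → V} {T : List Atom} (sJ : Support J T) where

  H U : List Atom
  H = filter (λ a → J a ≟ᵥ v2) T
  U = filter (λ a → J a ≟ᵥ v1) T

  ∈H⇒v2 : ∀ {a} → a ∈ H → J a ≡ v2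
  ∈H⇒v2 = proj₂ ∘′ ∈-filter⁻ (λ a → J a ≟ᵥ v2) {xs = T}

  ∈U⇒v1 : ∀ {a} → a ∈ U → J a ≡ v1
  ∈U⇒v1 = proj₂ ∘′ ∈-filter⁻ (λ a → J a ≟ᵥ v1) {xs = T}

  -- Among the G₃-models of pin that are non-zero exactly on T, only J takes the value 1.
  pin : Program
  pin = facts H ++ map (λ a → ¬f ¬f atom a) T ++ cartesianProductWith (λ a b → atom a ⇐ atom b) U U

  J⊨pin : J ⊨ pin
  J⊨pin = AllP.++⁺ (AllP.map⁺ (All.tabulate ∈H⇒v2))
         (AllP.++⁺ (AllP.map⁺ (All.tabulate (¬¬-positive ∘′ support-∈ sJ))) (All.tabulate pinned))
    where
    pinned : ∀ {F} → F ∈ cartesianProductWith (λ a b → atom a ⇐ atom b) U U → evalV J F ≡ v2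
    pinned F∈ with a , b , a∈U , b∈U , refl ← ∈-cartesianProductWith⁻ (λ a b → atom a ⇐ atom b) U U F∈
      rewrite ∈U⇒v1 a∈U | ∈U⇒v1 b∈U = refl

  pin-model⇒⊇T : ∀ {M′} → IsModel pin M′ → T ⊆ M′
  pin-model⇒⊇T {M′} model = ¬¬-model⇒⊆ (AllP.++⁻ˡ _ (AllP.++⁻ʳ (facts H) model))

  module _ {J′ : Atom → V} (J′⊨pin : J′ ⊨ pin) where

    pin-fact : ∀ {c} → c ∈ H → J′ c ≡ v2
    pin-fact = All.lookup (AllP.map⁻ (AllP.++⁻ˡ (facts H) J′⊨pin))

    pin-pair : ∀ {c d} → c ∈ U → d ∈ U → J′ c ⇐ᵥ J′ d ≡ v2
    pin-pair c∈U d∈U = All.lookup J′⊨pin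
      (∈-++⁺ʳ (facts H) (∈-++⁺ʳ _ (∈-cartesianProductWith⁺ (λ a b → atom a ⇐ atom b) c∈U d∈U)))

    pin-v1 : ∀ {a} → a ∈ T → J′ a ≡ v1 → a ∈ U
    pin-v1 {a} a∈T J′a≡v1 with J a in Ja
    ... | v0 = contradiction Ja (support-∈ sJ a∈T)
    ... | v1 = ∈-filter⁺ (λ a → J a ≟ᵥ v1) a∈T Ja
    ... | v2 with () ← trans (sym J′a≡v1) (pin-fact (∈-filter⁺ (λ a → J a ≟ᵥ v2) a∈T Ja))

  pin-determines : ∀ {J′} → Support J′ T → J′ ⊨ pin → ∀ {a} → a ∈ T → J′ a ≡ v1 → J′ ≗ J
  pin-determines {J′} sJ′ J′⊨pin {a} a∈T J′a≡v1 b with b ∈? T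
  ... | no  b∉T = trans (support-∉ sJ′ b∉T) (sym (support-∉ sJ b∉T))
  ... | yes b∈T with J b in Jb
  ...   | v0 = contradiction Jb (support-∈ sJ b∈T)
  ...   | v2 = pin-fact J′⊨pin (∈-filter⁺ (λ a → J a ≟ᵥ v2) b∈T Jb)
  ...   | v1 = ⇐ᵥ-pinned (subst (λ x → x ⇐ᵥ J′ b ≡ v2) J′a≡v1 (pin-pair J′⊨pin a∈U b∈U))
                         (subst (λ x → J′ b ⇐ᵥ x ≡ v2) J′a≡v1 (pin-pair J′⊨pin b∈U a∈U))
    where
    a∈U : a ∈ U
    a∈U = pin-v1 J′⊨pin a∈T J′a≡v1
    b∈U : b ∈ U
    b∈U = ∈-filter⁺ (λ a → J a ≟ᵥ v1) b∈T Jb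

  pin-equilibrium : ∀ {Q} → ¬ J ⊨ Q → Equilibrium (Q ++ pin) T
  pin-equilibrium {Q} J⊭Q J′ sJ′ J′⊨Qpin {a} a∈T with J′ a in J′a
  ... | v0 = contradiction J′a (support-∈ sJ′ a∈T)
  ... | v1 = contradiction
    (⊨-cong (pin-determines sJ′ (AllP.++⁻ʳ Q J′⊨Qpin) a∈T J′a) (AllP.++⁻ˡ Q J′⊨Qpin)) J⊭Q
  ... | v2 = refl

module _ {P₁ P₂ : Program} (se : StronglyEquivalentMin P₁ P₂) where

  se⇒models : ∀ {M} → IsModel P₁ M → IsModel P₂ M
  se⇒models {M} model =
    AllP.++⁻ˡ P₂ (proj₁ (proj₂ (Equivalence.to (se (facts M) M) (facts-minAnswerSet model))))

  se⇒⊨₃-supported : ∀ {J T} → Support J T → J ⊨ P₁ → J ⊨ P₂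
  se⇒⊨₃-supported {J} {T} sJ J⊨P₁ = decidable-stable (J ⊨? P₂) λ J⊭P₂ →
    J⊭P₂ (⊨-cong (sym ∘ two-valued J⊭P₂) (model⇒⌜⌝⊨ T⊨P₂))
    where
    open Pin {T = T} sJ
    T⊨P₂ : IsModel P₂ T
    T⊨P₂ = se⇒models (⊨⇒model sJ J⊨P₁)
    two-valued : ¬ J ⊨ P₂ → J ≗ ⌜ T ⌝
    two-valued J⊭P₂ = support-two-valued sJ (equilibrium₁ J sJ (AllP.++⁺ J⊨P₁ J⊨pin))
      where
      minAnswerSet₂ : IsMinAnswerSet (P₂ ++ pin) T
      minAnswerSet₂ = Equivalence.from minAnswerSet⇔
        ( minimal-if-forced (AllP.++⁺ T⊨P₂ (⊨⇒model sJ J⊨pin)) (pin-model⇒⊇T ∘′ AllP.++⁻ʳ P₂)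
        , pin-equilibrium J⊭P₂ )
      equilibrium₁ : Equilibrium (P₁ ++ pin) T
      equilibrium₁ = proj₂ (Equivalence.to minAnswerSet⇔ (Equivalence.from (se pin T) minAnswerSet₂))

_↾_ : (Atom → V) → List Atom → Atom → V
(J ↾ A) a = if does (a ∈? A) then J a else v0

support-↾ : ∀ J A → Support (J ↾ A) (filter (T? ∘ positive ∘ J) A)
support-↾ J A a with a ∈? A
... | no a∉A = sym (dec-false (a ∈? _) (a∉A ∘ proj₁ ∘ ∈-filter⁻ (T? ∘ positive ∘ J)))
... | yes a∈A with positive (J a) in Ja
...   | true  = sym (dec-true (a ∈? _) (∈-filter⁺ (T? ∘ positive ∘ J) a∈A (subst T (sym Ja) _)))
...   | false =
  sym (dec-false (a ∈? _) λ a∈S → subst T Ja (proj₂ (∈-filter⁻ (T? ∘ positive ∘ J) {xs = A} a∈S)))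

↾-⊨⇔ : ∀ {J A Q} → σ Q ⊆ A → (J ↾ A) ⊨ Q ⇔ J ⊨ Q
↾-⊨⇔ {J} {A} {Q} σQ⊆A = mk⇔ (⊨-local evalV-↾) (⊨-local (sym ∘′ evalV-↾))
  where
  ↾-agrees : ∀ {a} → a ∈ A → (J ↾ A) a ≡ J a
  ↾-agrees {a} a∈A with a ∈? A
  ... | yes _   = refl
  ... | no  a∉A = contradiction a∈A a∉A
  evalV-↾ : ∀ {F} → F ∈ Q → evalV (J ↾ A) F ≡ evalV J F
  evalV-↾ {F} F∈Q = evalV-local F (↾-agrees ∘′ σQ⊆A ∘′ atomsF⊆σ F∈Q)

se⇒⊨₃ : ∀ {P₁ P₂} → StronglyEquivalentMin P₁ P₂ → P₁ ⊨₃ P₂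
se⇒⊨₃ {P₁} {P₂} se J J⊨P₁ =
  Equivalence.to (↾-⊨⇔ (∈-++⁺ʳ (σ P₁)))
    (se⇒⊨₃-supported se {T = filter (T? ∘ positive ∘ J) A} (support-↾ J A)
      (Equivalence.from (↾-⊨⇔ ∈-++⁺ˡ) J⊨P₁))
  where
  A : List Atom
  A = σ P₁ ++ σ P₂

se-sym : ∀ {P₁ P₂} → StronglyEquivalentMin P₁ P₂ → StronglyEquivalentMin P₂ P₁
se-sym se P M = ⇔-sym (se P M)

theorem5p6 : (P₁ P₂ : Program) → StronglyEquivalentMin P₁ P₂ ⇔ G3Equivalent P₁ P₂
theorem5p6 P₁ P₂ = mk⇔
  (λ se → ⊨₃⇒⊢G3 (se⇒⊨₃ se) , ⊨₃⇒⊢G3 (se⇒⊨₃ (se-sym se)))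
  (λ (P₁⊢P₂ , P₂⊢P₁) P M →
    let P₁⊨P₂ = ⊢G3⇒⊨₃ P₁⊢P₂
        P₂⊨P₁ = ⊢G3⇒⊨₃ P₂⊢P₁
    in mk⇔ (minAnswerSet-transfer (⊨₃-++ P₁⊨P₂ P) (⊨₃-++ P₂⊨P₁ P))
           (minAnswerSet-transfer (⊨₃-++ P₂⊨P₁ P) (⊨₃-++ P₁⊨P₂ P)))
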